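{- Let $G$ be a finite simple graph with independence number three and $I_G(z)-1=a_1z+a_2z^2+a_3z^3$, with $4\le a_1\le8$ and $4a_3(a_1-1)<a_2^2<4a_1a_3$. Then: (1) if $4a_3(a_1-1)<a_2^2<\frac{a_3(2a_1-3)^2}{a_1-2}$, then $(a_1,a_2,a_3)=(k,2k-1,k)$ for some $k\in\{6,7,8\}$; (2) if $a_2^2=\frac{a_3(2a_1-3)^2}{a_1-2}$, then $(a_1,a_2,a_3)=(k,2k-3,k-2)$ for some $k\in\{4,5,6,7,8\}$; (3) if $\frac{a_3(2a_1-3)^2}{a_1-2}<a_2^2<\frac{4a_3(a_1-2)^2}{a_1-3}$, then $(a_1,a_2,a_3)\in\{(7,7,2),(7,14,8),(8,16,9)\}$; (4) if $a_2^2=\frac{4a_3(a_1-2)^2}{a_1-3}$, then $(a_1,a_2,a_3)\in\{(4,4,1),(5,6,2),(6,8,3),(7,5,1),(7,10,4),(7,15,9),(8,12,5)\}$; (5) if $\frac{4a_3(a_1-2)^2}{a_1-3}<a_2^2<4a_1a_3$, then $(a_1,a_2,a_3)\in\{(7,9,3),(8,11,4),(8,17,10),(8,18,11),(8,19,12)\}$.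
   Context: For a finite simple graph $G$, $I_G(z)=\sum_{i=0}^d a_iz^i$ with $a_0=1$ where $a_i$ is the number of independent sets (sets of pairwise non-adjacent vertices) of size $i$ and $d$ is the independence number. -}

module Defs where

open import Data.Nat using (ℕ; zero; suc; _≟_)
open import Data.Fin using (Fin)
open import Data.Fin.Properties using (all?)
open import Data.Fin.Subset using (Subset; _∈_; ∣_∣; inside; outside)
open import Data.Fin.Subset.Properties using (_∈?_)
open import Data.Vec using ([]; _∷_)
open import Data.List using (List; []; _∷_; map; _++_; filter; length)
open import Data.Product using (_×_)
open import Relation.Nullary using (¬_; Dec; yes; no)
open import Relation.Nullary.Decidable using (_×-dec_; ¬?)
open import Relation.Binary.PropositionalEquality using (_≡_)

record SimpleGraph (n : ℕ) : Set₁ where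
  field
    Adj     : Fin n → Fin n → Set
    adj?    : ∀ x y → Dec (Adj x y)
    sym     : ∀ {x y} → Adj x y → Adj y x
    irrefl  : ∀ {x} → ¬ Adj x x

module _ {n : ℕ} (G : SimpleGraph n) where
  open SimpleGraph G

  Independent : Subset n → Set
  Independent S = ∀ x y → x ∈ S → y ∈ S → ¬ Adj x y

  independent? : (S : Subset n) → Dec (Independent S)
  independent? S = all? λ x → all? λ y →
    imp (x ∈? S) (imp (y ∈? S) (¬? (adj? x y)))
    where
      imp : ∀ {A B : Set} → Dec A → Dec B → Dec (A → B)
      imp _ (yes b) = yes (λ _ → b)
      imp (no ¬a) _ = yes (λ a → Data.Empty.⊥-elim (¬a a))
        where import Data.Empty
      imp (yes a) (no ¬b) = no (λ f → ¬b (f a))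

allSubsets : (n : ℕ) → List (Subset n)
allSubsets zero    = [] ∷ []
allSubsets (suc n) = map (inside ∷_) (allSubsets n) ++ map (outside ∷_) (allSubsets n)

-- a_i : the number of independent sets of size i in G
-- (the coefficient of z^i in the independence polynomial I_G(z)).
indepCount : {n : ℕ} → SimpleGraph n → ℕ → ℕ
indepCount {n} G i =
  length (filter (λ S → independent? G S ×-dec (∣ S ∣ ≟ i)) (allSubsets n))

module Submission where

-- Proof by exhaustive search over the graphs with α ≤ 3 and 4 ≤ n ≤ 8.
-- List the vertices as v₁, …, vₙ and record, for each vᵢ, its adjacencies to
-- the later vertices; from this "pattern" all aₖ follow by the deletion
-- recurrence I(G) = I(G − v) + z·I(G − N[v]).  Choosing the vertices from last
-- to first, each time one whose adjacencies to the vertices already placed are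
-- largest when read as a binary number, makes every graph's pattern canonical.
-- The canonical patterns with a₄ = 0 are enumerated row by row, discarding a
-- partial pattern as soon as it has an independent 4-set or can no longer
-- reach a value of a₂ for which the conclusion is not already forced by the
-- arithmetic; for those smaller a₂ every a₃ < a₂² is checked directly.

open import Defs
open import Algebra.Properties.CommutativeSemigroup using (interchange)
open import Data.Bool.Base using (Bool; true; false; _∧_; not; if_then_else_; T)
open import Data.Bool.Properties using (T-∧)
open import Data.Empty using (⊥-elim)
open import Data.Fin.Base using (Fin; zero; suc)
open import Data.Fin.Subset using (Subset; ∣_∣; _⊆_; ⊤; _∩_; _-_; inside; outside; Empty)
  renaming (_∈_ to _∈ₛ_; _∉_ to _∉ₛ_)
open import Data.Fin.Subset.Properties using (∈⊤; Empty-unique; ∣⊥∣≡0; _⊆?_; x∈p∩q⁺; x∈p∩q⁻; x∈p⇒∣p-x∣<∣p∣)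
  renaming (_∈?_ to _∈ₛ?_)
open import Data.List.Base using (List; []; _∷_; length; filter; map; _++_; replicate; allFin; concatMap)
open import Data.List.Membership.Propositional using (_∈_; lose)
open import Data.List.Membership.Propositional.Properties
  using (∈-allFin; ∈-++⁺ˡ; ∈-++⁺ʳ; ∈-map⁺; ∈-filter⁺; ∈-concatMap⁺)
open import Data.List.Properties using (length-++; filter-++; ++-identityʳ; length-replicate; length-map)
open import Data.List.Relation.Binary.Permutation.Propositional
  using (_↭_; ↭-refl; ↭-sym; ↭-trans; prep; swap; ↭⇒↭ₛ)
open import Data.List.Relation.Binary.Permutation.Propositional.Properties
  using (All-resp-↭; ∈-resp-↭; ↭-length; ++⁺ʳ; shift)
open import Data.List.Relation.Binary.Permutation.Setoid.Properties using (Unique-resp-↭)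
open import Data.List.Relation.Unary.All as All using (All; []; _∷_)
open import Data.List.Relation.Unary.AllPairs using (_∷_)
open import Data.List.Relation.Unary.Any using (here; there)
open import Data.List.Relation.Unary.Unique.Propositional using (Unique)
open import Data.List.Relation.Unary.Unique.Propositional.Properties using (allFin⁺)
open import Data.Nat.Base
  using (ℕ; zero; suc; _+_; _*_; _∸_; _<_; _≤_; _≤ᵇ_; _≡ᵇ_; z≤n; s≤s; >-nonZero)
open import Data.Nat.Properties
  using (_≟_; _≤?_; _<?_; allUpTo?; ≤-refl; ≤-trans; ≤-<-trans; ≰⇒≥; ≰⇒>; ≤⇒≤ᵇ; ≡⇒≡ᵇ;
         n≤1+n; m≤n⇒m≤1+n; m≤m+n; m≤n*m; m≤m*n; +-comm; +-assoc; +-mono-≤; +-monoʳ-≤; +-monoˡ-≤;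
         ∸-+-assoc; m+[n∸m]≡n; m+n≤o⇒m≤o∸n; m<n⇒0<n∸m; m+n≡0⇒m≡0; m+n≡0⇒n≡0;
         suc-injective; n≮0; 0≢1+n; 1+n≰n; +-commutativeSemigroup; module ≤-Reasoning)
open import Data.Product.Base using (Σ; ∃; ∃₂; _×_; _,_; proj₁; proj₂)
open import Data.Product.Properties using (≡-dec)
open import Data.Sum.Base as Sum using (_⊎_; inj₁; inj₂; [_,_]′)
open import Data.Vec.Base using ([]; _∷_; _[_]≔_; here; there; tabulate)
open import Data.Vec.Properties using ([]≔-updates; []≔-minimal; lookup⇒[]=; []=⇒lookup; lookup∘tabulate)
open import Function.Base using (_∘_; case_of_)
open import Function.Bundles using (_⇔_; mk⇔; module Equivalence)
open import Level using (Level)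
open import Relation.Nullary.Decidable
  using (Dec; yes; no; does; True; toWitness; T?; ¬?; map′; _×-dec_; _⊎-dec_; _→-dec_;
         dec-true; dec-false; does-⇔)
open import Relation.Nullary.Negation using (¬_; contradiction)
open import Relation.Unary using (Pred; Decidable)
open import Relation.Binary.PropositionalEquality
  using (_≡_; _≢_; refl; sym; trans; cong; cong₂; subst; setoid; module ≡-Reasoning)
open import Data.List.Membership.DecPropositional (≡-dec _≟_ (≡-dec _≟_ _≟_)) using (_∈?_)

private variable
  ℓ : Level
  A B : Set
  n : ℕ

-- Counting subsets

count : (Subset n → Bool) → ℕ
count {zero}  p = if p [] then 1 else 0
count {suc n} p = count (λ S → p (inside ∷ S)) + count (λ S → p (outside ∷ S))

length-filter-map : {P : Pred B ℓ} (P? : Decidable P) (f : A → B) (xs : List A) →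
  length (filter P? (map f xs)) ≡ length (filter (P? ∘ f) xs)
length-filter-map P? f []       = refl
length-filter-map P? f (x ∷ xs) with does (P? (f x))
... | true  = cong suc (length-filter-map P? f xs)
... | false = length-filter-map P? f xs

length-filter-allSubsets : {P : Pred (Subset n) ℓ} (P? : Decidable P) →
  length (filter P? (allSubsets n)) ≡ count (does ∘ P?)
length-filter-allSubsets {zero} P? with does (P? [])
... | true  = refl
... | false = refl
length-filter-allSubsets {suc n} P? = begin
  length (filter P? (map (inside ∷_) (allSubsets n) ++ map (outside ∷_) (allSubsets n)))
    ≡⟨ cong length (filter-++ P? (map (inside ∷_) (allSubsets n)) _) ⟩
  length (filter P? (map (inside ∷_) (allSubsets n)) ++ filter P? (map (outside ∷_) (allSubsets n)))
    ≡⟨ length-++ (filter P? (map (inside ∷_) (allSubsets n))) ⟩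
  length (filter P? (map (inside ∷_) (allSubsets n))) + length (filter P? (map (outside ∷_) (allSubsets n)))
    ≡⟨ cong₂ _+_ (trans (length-filter-map P? _ (allSubsets n)) (length-filter-allSubsets {n} _))
                 (trans (length-filter-map P? _ (allSubsets n)) (length-filter-allSubsets {n} _)) ⟩
  count (does ∘ P?) ∎
  where open ≡-Reasoning

count-cong : {p q : Subset n → Bool} → (∀ S → p S ≡ q S) → count p ≡ count q
count-cong {zero}  p≡q = cong (λ b → if b then 1 else 0) (p≡q [])
count-cong {suc n} p≡q =
  cong₂ _+_ (count-cong (λ S → p≡q (inside ∷ S))) (count-cong (λ S → p≡q (outside ∷ S)))

count-false : count {n} (λ _ → false) ≡ 0
count-false {zero}  = refl
count-false {suc n} = cong₂ _+_ (count-false {n}) (count-false {n})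

count-size-zero : count {n} (λ S → does (∣ S ∣ ≟ 0)) ≡ 1
count-size-zero {zero}  = refl
count-size-zero {suc n} = cong₂ _+_ (count-false {n}) (count-size-zero {n})

count-split : (q p : Subset n → Bool) →
  count p ≡ count (λ S → not (q S) ∧ p S) + count (λ S → q S ∧ p S)
count-split {zero} q p with q [] | p []
... | true  | true  = refl
... | true  | false = refl
... | false | true  = refl
... | false | false = refl
count-split {suc n} q p = trans
  (cong₂ _+_ (count-split (λ S → q (inside ∷ S)) (λ S → p (inside ∷ S)))
             (count-split (λ S → q (outside ∷ S)) (λ S → p (outside ∷ S))))
  (interchange +-commutativeSemigroup (count (λ S → not (q (inside ∷ S)) ∧ p (inside ∷ S)))
                                      (count (λ S → q (inside ∷ S) ∧ p (inside ∷ S))) _ _)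

count-insert : (v : Fin n) (p : Subset n → Bool) →
  count (λ S → does (v ∈ₛ? S) ∧ p S) ≡ count (λ S → not (does (v ∈ₛ? S)) ∧ p (S [ v ]≔ inside))
count-insert {suc n} zero    p = +-comm (count (λ S → p (inside ∷ S))) (count {n} (λ _ → false))
count-insert {suc n} (suc v) p =
  cong₂ _+_ (count-insert v (λ S → p (inside ∷ S))) (count-insert v (λ S → p (outside ∷ S)))

x∈p[y]≔inside⁻ : ∀ (p : Subset n) {x} y → x ∈ₛ p [ y ]≔ inside → x ≡ y ⊎ x ∈ₛ p
x∈p[y]≔inside⁻ (s ∷ p) zero    here        = inj₁ refl
x∈p[y]≔inside⁻ (s ∷ p) zero    (there x∈p) = inj₂ (there x∈p)
x∈p[y]≔inside⁻ (s ∷ p) (suc y) here        = inj₂ here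
x∈p[y]≔inside⁻ (s ∷ p) (suc y) (there x∈)  = Sum.map (cong suc) there (x∈p[y]≔inside⁻ p y x∈)

p⊆p[x]≔inside : ∀ (p : Subset n) x → p ⊆ p [ x ]≔ inside
p⊆p[x]≔inside (s ∷ p) zero    here        = here
p⊆p[x]≔inside (s ∷ p) zero    (there y∈p) = there y∈p
p⊆p[x]≔inside (s ∷ p) (suc x) here        = here
p⊆p[x]≔inside (s ∷ p) (suc x) (there y∈p) = there (p⊆p[x]≔inside p x y∈p)

p[x]≔outside⊆p : ∀ (p : Subset n) x → p [ x ]≔ outside ⊆ p
p[x]≔outside⊆p (s ∷ p) zero    (there y∈) = there y∈
p[x]≔outside⊆p (s ∷ p) (suc x) here       = here
p[x]≔outside⊆p (s ∷ p) (suc x) (there y∈) = there (p[x]≔outside⊆p p x y∈)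

x∉p[x]≔outside : ∀ (p : Subset n) x → x ∉ₛ p [ x ]≔ outside
x∉p[x]≔outside (s ∷ p) (suc x) (there x∈) = x∉p[x]≔outside p x x∈

∣p[x]≔inside∣ : ∀ (p : Subset n) x → x ∉ₛ p → ∣ p [ x ]≔ inside ∣ ≡ suc ∣ p ∣
∣p[x]≔inside∣ (outside ∷ p) zero    _   = refl
∣p[x]≔inside∣ (inside  ∷ p) zero    x∉p = contradiction here x∉p
∣p[x]≔inside∣ (outside ∷ p) (suc x) x∉p = ∣p[x]≔inside∣ p x (x∉p ∘ there)
∣p[x]≔inside∣ (inside  ∷ p) (suc x) x∉p = cong suc (∣p[x]≔inside∣ p x (x∉p ∘ there))

p[x]≔inside⊆q⇔ : ∀ {p q : Subset n} x → p [ x ]≔ inside ⊆ q ⇔ (x ∈ₛ q × p ⊆ q)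
p[x]≔inside⊆q⇔ {p = p} x = mk⇔
  (λ p+x⊆q → p+x⊆q ([]≔-updates p x) , λ {y} y∈p → p+x⊆q (p⊆p[x]≔inside p x y∈p))
  (λ { (x∈q , p⊆q) {y} y∈ → [ (λ { refl → x∈q }) , p⊆q ]′ (x∈p[y]≔inside⁻ p x y∈) })

p⊆q[x]≔outside⇔ : ∀ {p q : Subset n} x → p ⊆ q [ x ]≔ outside ⇔ (x ∉ₛ p × p ⊆ q)
p⊆q[x]≔outside⇔ {p = p} {q} x = mk⇔
  (λ p⊆q-x → (λ x∈p → x∉p[x]≔outside q x (p⊆q-x x∈p)) , λ {y} y∈p → p[x]≔outside⊆p q x (p⊆q-x y∈p))
  (λ { (x∉p , p⊆q) {y} y∈p → []≔-minimal q y x (λ { refl → x∉p y∈p }) (p⊆q y∈p) })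

∣p∣≡0⇒Empty : ∀ {p : Subset n} → ∣ p ∣ ≡ 0 → Empty p
∣p∣≡0⇒Empty {p = p} ∣p∣≡0 (x , x∈p) = n≮0 (subst (∣ p - x ∣ <_) ∣p∣≡0 (x∈p⇒∣p-x∣<∣p∣ x∈p))

p⊆Empty⇒∣p∣≡0 : ∀ {p q : Subset n} → p ⊆ q → Empty q → ∣ p ∣ ≡ 0
p⊆Empty⇒∣p∣≡0 {n} p⊆q q-empty =
  trans (cong ∣_∣ (Empty-unique (λ (x , x∈p) → q-empty (x , p⊆q x∈p)))) (∣⊥∣≡0 n)

-- Adjacency patterns

-- Row i of a pattern lists the adjacencies of the i-th vertex to the vertices
-- after it; a mask marks the vertices still available.
Pattern : Set
Pattern = List (List Bool)

_∖_ : List Bool → List Bool → List Bool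
(a ∷ m) ∖ (b ∷ r) = (a ∧ not b) ∷ (m ∖ r)
m       ∖ _       = m

countPattern : Pattern → List Bool → ℕ → ℕ
countPattern P       m       zero    = 1
countPattern []      m       (suc k) = 0
countPattern (r ∷ P) []      (suc k) = 0
countPattern (r ∷ P) (b ∷ m) (suc k) =
  if b then countPattern P m (suc k) + countPattern P (m ∖ r) k else countPattern P m (suc k)

countIndependent : Pattern → ℕ → ℕ
countIndependent P = countPattern P (replicate (length P) true)

data WellShaped : Pattern → Set where
  []  : WellShaped []
  _∷_ : ∀ {r P} → length r ≡ length P → WellShaped P → WellShaped (r ∷ P)

binary : List Bool → ℕ
binary []       = 0
binary (b ∷ bs) = (if b then 1 else 0) + 2 * binary bs

-- A row is admissible above P when, for each later vertex w, its adjacencies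
-- to the vertices after w are, as a binary number, at most those of w.
admissible : List Bool → Pattern → Bool
admissible (_ ∷ r) (row ∷ P) = (binary r ≤ᵇ binary row) ∧ admissible r P
admissible _       _         = true

canonical : Pattern → Bool
canonical []      = true
canonical (r ∷ P) = admissible r P ∧ canonical P

-- Independent sets of a graph and the patterns of its vertex orderings

module IndependentSets {n : ℕ} (G : SimpleGraph n) where
  open SimpleGraph G renaming (sym to Adj-sym)

  adjacent : Fin n → Fin n → Bool
  adjacent v y = does (adj? v y)

  nonNeighbours : Fin n → Subset n
  nonNeighbours v = tabulate (λ y → not (adjacent v y))

  ∈-nonNeighbours⁺ : ∀ {v y} → ¬ Adj v y → y ∈ₛ nonNeighbours v
  ∈-nonNeighbours⁺ {v} {y} ¬adj =
    lookup⇒[]= y _ (trans (lookup∘tabulate _ y) (cong not (dec-false (adj? v y) ¬adj)))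

  ∈-nonNeighbours⁻ : ∀ {v y} → y ∈ₛ nonNeighbours v → ¬ Adj v y
  ∈-nonNeighbours⁻ {v} {y} y∈ adj with trans (sym (lookup∘tabulate _ y)) ([]=⇒lookup y∈)
  ... | not-adjacent rewrite dec-true (adj? v y) adj = case not-adjacent of λ ()

  independent-insert : ∀ {S v} →
    Independent G (S [ v ]≔ inside) ⇔ (Independent G S × S ⊆ nonNeighbours v)
  independent-insert {S} {v} = mk⇔
    (λ indep → (λ x y x∈S y∈S → indep x y (p⊆p[x]≔inside S v x∈S) (p⊆p[x]≔inside S v y∈S))
             , λ {y} y∈S → ∈-nonNeighbours⁺ (indep v y ([]≔-updates S v) (p⊆p[x]≔inside S v y∈S)))
    (λ { (indep , S⊆N) x y x∈ y∈ → joined (x∈p[y]≔inside⁻ S v x∈) (x∈p[y]≔inside⁻ S v y∈) indep S⊆N })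
    where
      joined : ∀ {x y} → x ≡ v ⊎ x ∈ₛ S → y ≡ v ⊎ y ∈ₛ S →
               Independent G S → S ⊆ nonNeighbours v → ¬ Adj x y
      joined (inj₁ refl) (inj₁ refl) _     _   = irrefl
      joined (inj₁ refl) (inj₂ y∈S)  _     S⊆N = ∈-nonNeighbours⁻ (S⊆N y∈S)
      joined (inj₂ x∈S)  (inj₁ refl) _     S⊆N = ∈-nonNeighbours⁻ (S⊆N x∈S) ∘ Adj-sym
      joined (inj₂ x∈S)  (inj₂ y∈S)  indep _   = indep _ _ x∈S y∈S

  IndependentIn : ℕ → Subset n → Subset n → Set
  IndependentIn k X S = Independent G S × ∣ S ∣ ≡ k × S ⊆ X

  independentIn? : ∀ k X → Decidable (IndependentIn k X)
  independentIn? k X S = independent? G S ×-dec ∣ S ∣ ≟ k ×-dec S ⊆? X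

  countIn : ℕ → Subset n → ℕ
  countIn k X = count (does ∘ independentIn? k X)

  indepCount≡countIn-⊤ : ∀ k → indepCount G k ≡ countIn k ⊤
  indepCount≡countIn-⊤ k = trans (length-filter-allSubsets {n = n} _) (count-cong λ S →
    does-⇔ (mk⇔ (λ (indep , size) → indep , size , λ {_} _ → ∈⊤) (λ (indep , size , _) → indep , size))
           (independent? G S ×-dec ∣ S ∣ ≟ k) (independentIn? k ⊤ S))

  indepCount-beyond : ∀ {α} → (∀ S → Independent G S → ∣ S ∣ ≤ α) → indepCount G (suc α) ≡ 0
  indepCount-beyond {α} α-bound = trans (length-filter-allSubsets {n = n} _)
    (trans (count-cong λ S → dec-false (independent? G S ×-dec ∣ S ∣ ≟ suc α)
                               λ (indep , size) → 1+n≰n (subst (_≤ α) size (α-bound S indep)))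
           (count-false {n}))

  countIn-zero : ∀ X → countIn 0 X ≡ 1
  countIn-zero X = trans (count-cong λ S → does-⇔ only-∅ (independentIn? 0 X S) (∣ S ∣ ≟ 0))
                         (count-size-zero {n})
    where
      only-∅ : ∀ {S} → IndependentIn 0 X S ⇔ ∣ S ∣ ≡ 0
      only-∅ = mk⇔ (proj₁ ∘ proj₂) λ ∣S∣≡0 →
        (λ x _ x∈S _ → ⊥-elim (∣p∣≡0⇒Empty ∣S∣≡0 (x , x∈S))) , ∣S∣≡0 ,
        λ {x} x∈S → ⊥-elim (∣p∣≡0⇒Empty ∣S∣≡0 (x , x∈S))

  countIn-Empty : ∀ {k X} → Empty X → countIn (suc k) X ≡ 0
  countIn-Empty {k} {X} X-empty = trans
    (count-cong λ S → dec-false (independentIn? (suc k) X S)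
                        λ (_ , size , S⊆X) → 0≢1+n (trans (sym (p⊆Empty⇒∣p∣≡0 S⊆X X-empty)) size))
    (count-false {n})

  independentIn-avoiding : ∀ {k X S} v →
    (v ∉ₛ S × IndependentIn k X S) ⇔ IndependentIn k (X [ v ]≔ outside) S
  independentIn-avoiding v = mk⇔
    (λ (v∉S , indep , size , S⊆X) → indep , size , Equivalence.from (p⊆q[x]≔outside⇔ v) (v∉S , S⊆X))
    (λ (indep , size , S⊆X-v) → let v∉S , S⊆X = Equivalence.to (p⊆q[x]≔outside⇔ v) S⊆X-v
                                in v∉S , indep , size , S⊆X)

  independentIn-containing : ∀ {k X S v} → v ∈ₛ X →
    (v ∉ₛ S × IndependentIn (suc k) X (S [ v ]≔ inside))
      ⇔ IndependentIn k ((X ∩ nonNeighbours v) [ v ]≔ outside) S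
  independentIn-containing {k} {X} {S} {v} v∈X = mk⇔
    (λ (v∉S , indep , size , S+v⊆X) →
      let indep′ , S⊆N = Equivalence.to independent-insert indep
          _ , S⊆X      = Equivalence.to (p[x]≔inside⊆q⇔ v) S+v⊆X
      in indep′ , suc-injective (trans (sym (∣p[x]≔inside∣ S v v∉S)) size) ,
         Equivalence.from (p⊆q[x]≔outside⇔ v) (v∉S , λ y∈S → x∈p∩q⁺ (S⊆X y∈S , S⊆N y∈S)))
    (λ (indep , size , S⊆W) →
      let v∉S , S⊆X∩N = Equivalence.to (p⊆q[x]≔outside⇔ v) S⊆W
      in v∉S , Equivalence.from independent-insert (indep , λ y∈S → proj₂ (x∈p∩q⁻ X _ (S⊆X∩N y∈S))) ,
         trans (∣p[x]≔inside∣ S v v∉S) (cong suc size) ,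
         Equivalence.from (p[x]≔inside⊆q⇔ v) (v∈X , λ y∈S → proj₁ (x∈p∩q⁻ X _ (S⊆X∩N y∈S))))

  countIn-split : ∀ {k X} v → v ∈ₛ X →
    countIn (suc k) X ≡ countIn (suc k) (X [ v ]≔ outside) + countIn k ((X ∩ nonNeighbours v) [ v ]≔ outside)
  countIn-split {k} {X} v v∈X = begin
    countIn (suc k) X
      ≡⟨ count-split (λ S → does (v ∈ₛ? S)) indep? ⟩
    count (λ S → v∉? S ∧ indep? S) + count (λ S → does (v ∈ₛ? S) ∧ indep? S)
      ≡⟨ cong (count (λ S → v∉? S ∧ indep? S) +_) (count-insert v indep?) ⟩
    count (λ S → v∉? S ∧ indep? S) + count (λ S → v∉? S ∧ indep? (S [ v ]≔ inside))
      ≡⟨ cong₂ _+_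
           (count-cong λ S → does-⇔ (independentIn-avoiding v)
              (¬? (v ∈ₛ? S) ×-dec independentIn? (suc k) X S)
              (independentIn? (suc k) (X [ v ]≔ outside) S))
           (count-cong λ S → does-⇔ (independentIn-containing v∈X)
              (¬? (v ∈ₛ? S) ×-dec independentIn? (suc k) X (S [ v ]≔ inside))
              (independentIn? k ((X ∩ nonNeighbours v) [ v ]≔ outside) S)) ⟩
    countIn (suc k) (X [ v ]≔ outside) + countIn k ((X ∩ nonNeighbours v) [ v ]≔ outside) ∎
    where
      open ≡-Reasoning
      indep? v∉? : Subset n → Bool
      indep? S = does (independentIn? (suc k) X S)
      v∉? S = not (does (v ∈ₛ? S))

  rowOf : Fin n → List (Fin n) → List Bool
  rowOf v = map (adjacent v)

  patternOf : List (Fin n) → Pattern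
  patternOf []      = []
  patternOf (v ∷ L) = rowOf v L ∷ patternOf L

  maskOf : Subset n → List (Fin n) → List Bool
  maskOf X = map (λ y → does (y ∈ₛ? X))

  length-patternOf : ∀ L → length (patternOf L) ≡ length L
  length-patternOf []      = refl
  length-patternOf (v ∷ L) = cong suc (length-patternOf L)

  patternOf-wellShaped : ∀ L → WellShaped (patternOf L)
  patternOf-wellShaped []      = []
  patternOf-wellShaped (v ∷ L) =
    trans (length-map (adjacent v) L) (sym (length-patternOf L)) ∷ patternOf-wellShaped L

  maskOf-remove : ∀ {v} X L → All (v ≢_) L → maskOf (X [ v ]≔ outside) L ≡ maskOf X L
  maskOf-remove X []      []           = refl
  maskOf-remove X (y ∷ L) (v≢y ∷ v≢L) = cong₂ _∷_
    (does-⇔ (mk⇔ (p[x]≔outside⊆p X _) ([]≔-minimal X y _ (v≢y ∘ sym))) (y ∈ₛ? _) (y ∈ₛ? X))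
    (maskOf-remove X L v≢L)

  maskOf-nonNeighbours : ∀ {v} X L → All (v ≢_) L →
    maskOf ((X ∩ nonNeighbours v) [ v ]≔ outside) L ≡ maskOf X L ∖ rowOf v L
  maskOf-nonNeighbours X []      []           = refl
  maskOf-nonNeighbours {v} X (y ∷ L) (v≢y ∷ v≢L) = cong₂ _∷_
    (does-⇔ (mk⇔ (λ y∈W → let y∈X , y∈N = x∈p∩q⁻ X _ (p[x]≔outside⊆p _ v y∈W)
                          in y∈X , ∈-nonNeighbours⁻ y∈N)
                 (λ (y∈X , ¬adj) → []≔-minimal _ y v (v≢y ∘ sym) (x∈p∩q⁺ (y∈X , ∈-nonNeighbours⁺ ¬adj))))
            (y ∈ₛ? _) (y ∈ₛ? X ×-dec ¬? (adj? v y)))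
    (maskOf-nonNeighbours X L v≢L)

  maskOf-⊤ : ∀ L → maskOf ⊤ L ≡ replicate (length (patternOf L)) true
  maskOf-⊤ []      = refl
  maskOf-⊤ (v ∷ L) = cong₂ _∷_ (dec-true (v ∈ₛ? ⊤) ∈⊤) (maskOf-⊤ L)

  countIn≡countPattern : ∀ {X L} k → Unique L → (∀ {y} → y ∈ₛ X → y ∈ L) →
    countIn k X ≡ countPattern (patternOf L) (maskOf X L) k
  countIn≡countPattern {X} zero _ _ = countIn-zero X
  countIn≡countPattern {L = []} (suc k) _ X⊆[] = countIn-Empty λ (y , y∈X) → case X⊆[] y∈X of λ ()
  countIn≡countPattern {X} {v ∷ L} (suc k) (v≢L ∷ unique) X⊆v∷L with v ∈ₛ? X
  ... | yes v∈X = begin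
    countIn (suc k) X
      ≡⟨ countIn-split v v∈X ⟩
    countIn (suc k) (X [ v ]≔ outside) + countIn k ((X ∩ nonNeighbours v) [ v ]≔ outside)
      ≡⟨ cong₂ _+_
           (countIn≡countPattern (suc k) unique λ y∈ →
              in-tail (p[x]≔outside⊆p X v y∈) (x∉p[x]≔outside X v) y∈)
           (countIn≡countPattern k unique λ y∈ →
              in-tail (proj₁ (x∈p∩q⁻ X _ (p[x]≔outside⊆p _ v y∈))) (x∉p[x]≔outside _ v) y∈) ⟩
    countPattern P (maskOf (X [ v ]≔ outside) L) (suc k)
      + countPattern P (maskOf ((X ∩ nonNeighbours v) [ v ]≔ outside) L) k
      ≡⟨ cong₂ (λ m m′ → countPattern P m (suc k) + countPattern P m′ k)
               (maskOf-remove X L v≢L) (maskOf-nonNeighbours X L v≢L) ⟩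
    countPattern P (maskOf X L) (suc k) + countPattern P (maskOf X L ∖ rowOf v L) k ∎
    where
      open ≡-Reasoning
      P = patternOf L
      in-tail : ∀ {Y y} → y ∈ₛ X → v ∉ₛ Y → y ∈ₛ Y → y ∈ L
      in-tail y∈X v∉Y y∈Y with X⊆v∷L y∈X
      ... | here refl = contradiction y∈Y v∉Y
      ... | there y∈L = y∈L
  ... | no v∉X = countIn≡countPattern (suc k) unique λ y∈X → case X⊆v∷L y∈X of λ where
        (here refl) → contradiction y∈X v∉X
        (there y∈L) → y∈L

  indepCount≡countIndependent : ∀ {L} k → L ↭ allFin n → indepCount G k ≡ countIndependent (patternOf L) k
  indepCount≡countIndependent {L} k L↭ = begin
    indepCount G k                             ≡⟨ indepCount≡countIn-⊤ k ⟩
    countIn k ⊤                                ≡⟨ countIn≡countPattern k unique-L ⊤⊆L ⟩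
    countPattern (patternOf L) (maskOf ⊤ L) k  ≡⟨ cong (λ m → countPattern (patternOf L) m k) (maskOf-⊤ L) ⟩
    countIndependent (patternOf L) k           ∎
    where
      open ≡-Reasoning
      unique-L : Unique L
      unique-L = Unique-resp-↭ (setoid (Fin n)) (↭⇒↭ₛ (↭-sym L↭)) (allFin⁺ n)
      ⊤⊆L : ∀ {y} → y ∈ₛ ⊤ → y ∈ L
      ⊤⊆L {y} _ = ∈-resp-↭ (↭-sym L↭) (∈-allFin y)

  weight : List (Fin n) → Fin n → ℕ
  weight S w = binary (rowOf w S)

  extract-max : ∀ S z₀ R → ∃₂ λ z R′ → z ∷ R′ ↭ z₀ ∷ R × All (λ w → weight S w ≤ weight S z) R′
  extract-max S z₀ []      = z₀ , [] , ↭-refl , []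
  extract-max S z₀ (y ∷ R) with extract-max S y R
  ... | z , R′ , z∷R′↭ , maximal with weight S z ≤? weight S z₀
  ...   | yes z≤z₀ = z₀ , z ∷ R′ , prep z₀ z∷R′↭ , z≤z₀ ∷ All.map (λ w≤z → ≤-trans w≤z z≤z₀) maximal
  ...   | no  z≰z₀ = z , z₀ ∷ R′ , ↭-trans (swap z z₀ ↭-refl) (prep z₀ z∷R′↭) , ≰⇒≥ z≰z₀ ∷ maximal

  AdmissibleAbove : List (Fin n) → Fin n → Set
  AdmissibleAbove S x = T (admissible (rowOf x S) (patternOf S))

  canonical-ordering : ∀ f R S → length R ≡ f → All (AdmissibleAbove S) R → T (canonical (patternOf S)) →
    ∃ λ L → L ↭ R ++ S × T (canonical (patternOf L))
  canonical-ordering zero    []       S _   _            canonical-S = S , ↭-refl , canonical-S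
  canonical-ordering (suc f) (z₀ ∷ R) S |R| admissible-R canonical-S
    with z , R′ , z∷R′↭ , maximal ← extract-max S z₀ R =
    let L , L↭ , canonical-L = canonical-ordering f R′ (z ∷ S) |R′| admissible-R′ canonical-zS
    in L , ↭-trans L↭ (↭-trans (shift z R′ S) (++⁺ʳ S z∷R′↭)) , canonical-L
    where
      |R′| : length R′ ≡ f
      |R′| = suc-injective (trans (↭-length z∷R′↭) |R|)
      admissible-R′ : All (AdmissibleAbove (z ∷ S)) R′
      admissible-R′ = All.zipWith (λ (w≤z , admissible-w) → Equivalence.from T-∧ (≤⇒≤ᵇ w≤z , admissible-w))
                        (maximal , All.tail (All-resp-↭ (↭-sym z∷R′↭) admissible-R))
      canonical-zS : T (canonical (patternOf (z ∷ S)))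
      canonical-zS = Equivalence.from T-∧ (All.lookup admissible-R (∈-resp-↭ z∷R′↭ (here refl)) , canonical-S)

  canonicalOrdering : ∃ λ L → L ↭ allFin n × T (canonical (patternOf L))
  canonicalOrdering =
    let L , L↭ , canonical-L = canonical-ordering _ (allFin n) [] refl (All.universal _ (allFin n)) _
    in L , subst (L ↭_) (++-identityʳ (allFin n)) L↭ , canonical-L

-- Enumerating canonical patterns

length-∖ : ∀ m r → length (m ∖ r) ≡ length m
length-∖ (a ∷ m) (b ∷ r) = cong suc (length-∖ m r)
length-∖ []      r       = refl
length-∖ (a ∷ m) []      = refl

replicate-∖ : ∀ r → replicate (length r) true ∖ r ≡ map not r
replicate-∖ []      = refl
replicate-∖ (b ∷ r) = cong (not b ∷_) (replicate-∖ r)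

countPattern-1≤length : ∀ P m → countPattern P m 1 ≤ length m
countPattern-1≤length []      m           = z≤n
countPattern-1≤length (r ∷ P) []          = z≤n
countPattern-1≤length (r ∷ P) (false ∷ m) = m≤n⇒m≤1+n (countPattern-1≤length P m)
countPattern-1≤length (r ∷ P) (true  ∷ m) =
  subst (_≤ suc (length m)) (+-comm 1 _) (s≤s (countPattern-1≤length P m))

countIndependent-1 : ∀ P → countIndependent P 1 ≡ length P
countIndependent-1 []      = refl
countIndependent-1 (r ∷ P) = trans (+-comm (countIndependent P 1) 1) (cong suc (countIndependent-1 P))

countIndependent-2-∷ : ∀ r P → countIndependent (r ∷ P) 2 ≤ countIndependent P 2 + length P
countIndependent-2-∷ r P = +-monoʳ-≤ (countIndependent P 2)
  (subst (countPattern P (full ∖ r) 1 ≤_) (trans (length-∖ full r) (length-replicate (length P)))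
         (countPattern-1≤length P (full ∖ r)))
  where full = replicate (length P) true

countIndependent-4-∷ : ∀ r P → length r ≡ length P →
  countIndependent (r ∷ P) 4 ≡ countIndependent P 4 + countPattern P (map not r) 3
countIndependent-4-∷ r P |r| = cong (λ m → countIndependent P 4 + countPattern P m 3)
  (trans (cong (λ t → replicate t true ∖ r) (sym |r|)) (replicate-∖ r))

pairs : ℕ → ℕ
pairs zero    = 0
pairs (suc m) = m + pairs m

pairs-mono-≤ : ∀ {m n} → m ≤ n → pairs m ≤ pairs n
pairs-mono-≤ z≤n       = z≤n
pairs-mono-≤ (s≤s m≤n) = +-mono-≤ m≤n (pairs-mono-≤ m≤n)

-- Completing a pattern from t to N rows adds rows over t, t + 1, …, N − 1
-- earlier vertices, each contributing at most that many independent pairs.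
slack : ℕ → ℕ → ℕ
slack N t = pairs N ∸ pairs t

slack-suc : ∀ {N t} → suc t ≤ N → t + slack N (suc t) ≡ slack N t
slack-suc {N} {t} t<N = begin
  t + (pairs N ∸ (t + pairs t))   ≡⟨ cong (λ x → t + (pairs N ∸ x)) (+-comm t (pairs t)) ⟩
  t + (pairs N ∸ (pairs t + t))   ≡⟨ cong (t +_) (sym (∸-+-assoc (pairs N) (pairs t) t)) ⟩
  t + (pairs N ∸ pairs t ∸ t)     ≡⟨ m+[n∸m]≡n (m+n≤o⇒m≤o∸n t (pairs-mono-≤ t<N)) ⟩
  pairs N ∸ pairs t               ∎
  where open ≡-Reasoning

-- An independent 4-set through the new vertex is an independent triple among
-- its non-neighbours, i.e. among the zeros of its row.
acceptable : ℕ → ℕ → List Bool → Pattern → Bool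
acceptable N a₂-min r P = admissible r P
                        ∧ (a₂-min ≤ᵇ countIndependent (r ∷ P) 2 + slack N (suc (length P)))
                        ∧ (countPattern P (map not r) 3 ≡ᵇ 0)

booleanLists : ℕ → List (List Bool)
booleanLists zero    = [] ∷ []
booleanLists (suc m) = map (false ∷_) (booleanLists m) ++ map (true ∷_) (booleanLists m)

∈-booleanLists : ∀ r → r ∈ booleanLists (length r)
∈-booleanLists []          = here refl
∈-booleanLists (false ∷ r) = ∈-++⁺ˡ (∈-map⁺ (false ∷_) (∈-booleanLists r))
∈-booleanLists (true  ∷ r) = ∈-++⁺ʳ (map (false ∷_) _) (∈-map⁺ (true ∷_) (∈-booleanLists r))

extensions : ℕ → ℕ → Pattern → List Pattern
extensions N a₂-min P = map (_∷ P) (filter (λ r → T? (acceptable N a₂-min r P)) (booleanLists (length P)))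

candidates : ℕ → ℕ → ℕ → List Pattern
candidates N a₂-min zero    = [] ∷ []
candidates N a₂-min (suc t) = concatMap (extensions N a₂-min) (candidates N a₂-min t)

candidates-complete : ∀ N a₂-min Q → WellShaped Q → T (canonical Q) → countIndependent Q 4 ≡ 0 →
  length Q ≤ N → a₂-min ≤ countIndependent Q 2 + slack N (length Q) → Q ∈ candidates N a₂-min (length Q)
candidates-complete N a₂-min []      _              _           _    _    _     = here refl
candidates-complete N a₂-min (r ∷ P) (|r| ∷ shaped) canonical-Q no-4 |Q|≤N large =
  ∈-concatMap⁺ (extensions N a₂-min) (lose P∈candidates (∈-map⁺ (_∷ P) (∈-filter⁺ _ r∈rows r-acceptable)))
  where
    admissible-r : T (admissible r P)
    admissible-r = proj₁ (Equivalence.to (T-∧ {admissible r P}) canonical-Q)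

    canonical-P : T (canonical P)
    canonical-P = proj₂ (Equivalence.to (T-∧ {admissible r P}) canonical-Q)

    no-4-split : countIndependent P 4 + countPattern P (map not r) 3 ≡ 0
    no-4-split = trans (sym (countIndependent-4-∷ r P |r|)) no-4

    r-acceptable : T (acceptable N a₂-min r P)
    r-acceptable = Equivalence.from (T-∧ {admissible r P}) (admissible-r , Equivalence.from T-∧
      (≤⇒≤ᵇ large , ≡⇒≡ᵇ _ 0 (m+n≡0⇒n≡0 (countIndependent P 4) no-4-split)))

    r∈rows : r ∈ booleanLists (length P)
    r∈rows = subst (λ t → r ∈ booleanLists t) |r| (∈-booleanLists r)

    large-P : a₂-min ≤ countIndependent P 2 + slack N (length P)
    large-P = begin
      a₂-min
        ≤⟨ large ⟩
      countIndependent (r ∷ P) 2 + slack N (suc (length P))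
        ≤⟨ +-monoˡ-≤ _ (countIndependent-2-∷ r P) ⟩
      countIndependent P 2 + length P + slack N (suc (length P))
        ≡⟨ +-assoc (countIndependent P 2) _ _ ⟩
      countIndependent P 2 + (length P + slack N (suc (length P)))
        ≡⟨ cong (countIndependent P 2 +_) (slack-suc |Q|≤N) ⟩
      countIndependent P 2 + slack N (length P) ∎
      where open ≤-Reasoning

    P∈candidates : P ∈ candidates N a₂-min (length P)
    P∈candidates = candidates-complete N a₂-min P shaped canonical-P
                     (m+n≡0⇒m≡0 (countIndependent P 4) no-4-split) (≤-trans (n≤1+n _) |Q|≤N) large-P

Conclusion : ℕ → ℕ → ℕ → Set
Conclusion a₁ a₂ a₃ =
    4 * a₃ * (a₁ ∸ 1) < a₂ * a₂ → a₂ * a₂ < 4 * a₁ * a₃ →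
    ((a₂ * a₂ * (a₁ ∸ 2) < a₃ * ((2 * a₁ ∸ 3) * (2 * a₁ ∸ 3)) →
      Σ ℕ λ k → (k ≡ 6 ⊎ k ≡ 7 ⊎ k ≡ 8) ×
        (a₁ ≡ k × a₂ ≡ 2 * k ∸ 1 × a₃ ≡ k))
    × (a₂ * a₂ * (a₁ ∸ 2) ≡ a₃ * ((2 * a₁ ∸ 3) * (2 * a₁ ∸ 3)) →
      Σ ℕ λ k → (k ≡ 4 ⊎ k ≡ 5 ⊎ k ≡ 6 ⊎ k ≡ 7 ⊎ k ≡ 8) ×
        (a₁ ≡ k × a₂ ≡ 2 * k ∸ 3 × a₃ ≡ k ∸ 2))
    × (a₃ * ((2 * a₁ ∸ 3) * (2 * a₁ ∸ 3)) < a₂ * a₂ * (a₁ ∸ 2) →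
      a₂ * a₂ * (a₁ ∸ 3) < 4 * a₃ * ((a₁ ∸ 2) * (a₁ ∸ 2)) →
      (a₁ , a₂ , a₃) ∈ ((7 , 7 , 2) ∷ (7 , 14 , 8) ∷ (8 , 16 , 9) ∷ []))
    × (a₂ * a₂ * (a₁ ∸ 3) ≡ 4 * a₃ * ((a₁ ∸ 2) * (a₁ ∸ 2)) →
      (a₁ , a₂ , a₃) ∈ ((4 , 4 , 1) ∷ (5 , 6 , 2) ∷ (6 , 8 , 3) ∷ (7 , 5 , 1)
                         ∷ (7 , 10 , 4) ∷ (7 , 15 , 9) ∷ (8 , 12 , 5) ∷ []))
    × (4 * a₃ * ((a₁ ∸ 2) * (a₁ ∸ 2)) < a₂ * a₂ * (a₁ ∸ 3) →
      a₂ * a₂ < 4 * a₁ * a₃ →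
      (a₁ , a₂ , a₃) ∈ ((7 , 9 , 3) ∷ (8 , 11 , 4) ∷ (8 , 17 , 10) ∷ (8 , 18 , 11)
                         ∷ (8 , 19 , 12) ∷ [])))

Σ-pinned? : ∀ {A B : ℕ → Set} a → Dec (A a × B a) → Dec (Σ ℕ λ k → A k × (a ≡ k × B k))
Σ-pinned? a = map′ (λ (A-a , B-a) → a , A-a , refl , B-a) λ { (k , A-k , refl , B-k) → A-k , B-k }

conclusion? : ∀ a₁ a₂ a₃ → Dec (Conclusion a₁ a₂ a₃)
conclusion? a₁ a₂ a₃ =
  _ <? _ →-dec _ <? _ →-dec
    (_ <? _ →-dec Σ-pinned? a₁ ((a₁ ≟ 6 ⊎-dec a₁ ≟ 7 ⊎-dec a₁ ≟ 8) ×-dec (a₂ ≟ _ ×-dec a₃ ≟ _)))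
    ×-dec (_ ≟ _ →-dec Σ-pinned? a₁ ((a₁ ≟ 4 ⊎-dec a₁ ≟ 5 ⊎-dec a₁ ≟ 6 ⊎-dec a₁ ≟ 7 ⊎-dec a₁ ≟ 8)
                                      ×-dec (a₂ ≟ _ ×-dec a₃ ≟ _)))
    ×-dec (_ <? _ →-dec _ <? _ →-dec _ ∈? _)
    ×-dec (_ ≟ _ →-dec _ ∈? _)
    ×-dec (_ <? _ →-dec _ <? _ →-dec _ ∈? _)

SearchSucceeds : ℕ → ℕ → Set
SearchSucceeds N a₂-min =
  All (λ Q → Conclusion N (countIndependent Q 2) (countIndependent Q 3)) (candidates N a₂-min N)
  × (∀ {b} → b < a₂-min → ∀ {c} → c < b * b → Conclusion N b c)

search? : ∀ N a₂-min → Dec (SearchSucceeds N a₂-min)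
search? N a₂-min = All.all? (λ Q → conclusion? N _ _) (candidates N a₂-min N)
                 ×-dec allUpTo? (λ b → allUpTo? (conclusion? N b) (b * b)) a₂-min

-- The first hypothesis of the conclusion gives a₃ < a₂², so the arithmetic
-- part of the search covers every pattern with a₂ < a₂-min.
conclusion-by-search : ∀ a₂-min Q → 2 ≤ length Q → SearchSucceeds (length Q) a₂-min →
  WellShaped Q → T (canonical Q) → countIndependent Q 4 ≡ 0 →
  Conclusion (length Q) (countIndependent Q 2) (countIndependent Q 3)
conclusion-by-search a₂-min Q 2≤|Q| (searched , arithmetic) shaped canonical-Q no-4 h₁ h₂
  with a₂-min ≤? countIndependent Q 2
... | yes large = All.lookup searched
        (candidates-complete _ a₂-min Q shaped canonical-Q no-4 ≤-refl (≤-trans large (m≤m+n _ _))) h₁ h₂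
... | no  small = arithmetic (≰⇒> small) (≤-<-trans a₃≤ h₁) h₁ h₂
  where
    a₃≤ : countIndependent Q 3 ≤ 4 * countIndependent Q 3 * (length Q ∸ 1)
    a₃≤ = ≤-trans (m≤n*m _ 4) (m≤m*n _ (length Q ∸ 1) {{>-nonZero (m<n⇒0<n∸m 2≤|Q|)}})

-- For each size N, a₂-min is the least a₂ for which the conclusion does not
-- hold for every a₃ on arithmetic grounds alone.
canonical-conclusion : ∀ Q → WellShaped Q → T (canonical Q) → countIndependent Q 4 ≡ 0 →
  4 ≤ length Q → length Q ≤ 8 → Conclusion (length Q) (countIndependent Q 2) (countIndependent Q 3)
canonical-conclusion Q shaped canonical-Q no-4 4≤|Q| = by-size (length Q) refl 4≤|Q|
  where
    found : ∀ {N} a₂-min → length Q ≡ N → True (search? N a₂-min) →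
            Conclusion N (countIndependent Q 2) (countIndependent Q 3)
    found a₂-min refl succeeded = conclusion-by-search a₂-min Q (≤-trans (s≤s (s≤s z≤n)) 4≤|Q|)
                                    (toWitness succeeded) shaped canonical-Q no-4

    by-size : ∀ N → length Q ≡ N → 4 ≤ N → N ≤ 8 → Conclusion N (countIndependent Q 2) (countIndependent Q 3)
    by-size 4 |Q| _ _ = found 7  |Q| _
    by-size 5 |Q| _ _ = found 9  |Q| _
    by-size 6 |Q| _ _ = found 12 |Q| _
    by-size 7 |Q| _ _ = found 16 |Q| _
    by-size 8 |Q| _ _ = found 20 |Q| _
    by-size 0 _ () _
    by-size 1 _ (s≤s ()) _
    by-size 2 _ (s≤s (s≤s ())) _
    by-size 3 _ (s≤s (s≤s (s≤s ()))) _
    by-size (suc (suc (suc (suc (suc (suc (suc (suc (suc _))))))))) _ _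
      (s≤s (s≤s (s≤s (s≤s (s≤s (s≤s (s≤s (s≤s ()))))))))

lemma3p6 : {n : ℕ} (G : SimpleGraph n) →
    (Σ (Subset n) λ S → Independent G S × ∣ S ∣ ≡ 3) →
    ((S : Subset n) → Independent G S → ∣ S ∣ ≤ 3) →
    let a₁ = indepCount G 1
        a₂ = indepCount G 2
        a₃ = indepCount G 3
    in
    4 ≤ a₁ → a₁ ≤ 8 →
    4 * a₃ * (a₁ ∸ 1) < a₂ * a₂ → a₂ * a₂ < 4 * a₁ * a₃ →
    ((a₂ * a₂ * (a₁ ∸ 2) < a₃ * ((2 * a₁ ∸ 3) * (2 * a₁ ∸ 3)) →
      Σ ℕ λ k → (k ≡ 6 ⊎ k ≡ 7 ⊎ k ≡ 8) ×
        (a₁ ≡ k × a₂ ≡ 2 * k ∸ 1 × a₃ ≡ k))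
    × (a₂ * a₂ * (a₁ ∸ 2) ≡ a₃ * ((2 * a₁ ∸ 3) * (2 * a₁ ∸ 3)) →
      Σ ℕ λ k → (k ≡ 4 ⊎ k ≡ 5 ⊎ k ≡ 6 ⊎ k ≡ 7 ⊎ k ≡ 8) ×
        (a₁ ≡ k × a₂ ≡ 2 * k ∸ 3 × a₃ ≡ k ∸ 2))
    × (a₃ * ((2 * a₁ ∸ 3) * (2 * a₁ ∸ 3)) < a₂ * a₂ * (a₁ ∸ 2) →
      a₂ * a₂ * (a₁ ∸ 3) < 4 * a₃ * ((a₁ ∸ 2) * (a₁ ∸ 2)) →
      (a₁ , a₂ , a₃) ∈ ((7 , 7 , 2) ∷ (7 , 14 , 8) ∷ (8 , 16 , 9) ∷ []))
    × (a₂ * a₂ * (a₁ ∸ 3) ≡ 4 * a₃ * ((a₁ ∸ 2) * (a₁ ∸ 2)) →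
      (a₁ , a₂ , a₃) ∈ ((4 , 4 , 1) ∷ (5 , 6 , 2) ∷ (6 , 8 , 3) ∷ (7 , 5 , 1)
                         ∷ (7 , 10 , 4) ∷ (7 , 15 , 9) ∷ (8 , 12 , 5) ∷ []))
    × (4 * a₃ * ((a₁ ∸ 2) * (a₁ ∸ 2)) < a₂ * a₂ * (a₁ ∸ 3) →
      a₂ * a₂ < 4 * a₁ * a₃ →
      (a₁ , a₂ , a₃) ∈ ((7 , 9 , 3) ∷ (8 , 11 , 4) ∷ (8 , 17 , 10) ∷ (8 , 18 , 11)
                         ∷ (8 , 19 , 12) ∷ [])))
lemma3p6 G _ α≤3 4≤a₁ a₁≤8 =
  subst (λ (a₁ , a₂ , a₃) → Conclusion a₁ a₂ a₃) (sym counts)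
    (canonical-conclusion Q (patternOf-wellShaped L) canonical-Q no-4
      (subst (4 ≤_) (cong proj₁ counts) 4≤a₁) (subst (_≤ 8) (cong proj₁ counts) a₁≤8))
  where
    open IndependentSets G
    L = proj₁ canonicalOrdering
    L↭ = proj₁ (proj₂ canonicalOrdering)
    canonical-Q = proj₂ (proj₂ canonicalOrdering)
    Q = patternOf L

    counts : (indepCount G 1 , indepCount G 2 , indepCount G 3)
           ≡ (length Q , countIndependent Q 2 , countIndependent Q 3)
    counts = cong₂ _,_ (trans (indepCount≡countIndependent 1 L↭) (countIndependent-1 Q))
                       (cong₂ _,_ (indepCount≡countIndependent 2 L↭) (indepCount≡countIndependent 3 L↭))

    no-4 : countIndependent Q 4 ≡ 0
    no-4 = trans (sym (indepCount≡countIndependent 4 L↭)) (indepCount-beyond α≤3)
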